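{- Let $H$ be a biconnected outerplane graph with $t$ inner triangles. Then: (1) If $t$ is even, then for every outeredge $xy$ of $H$ there is a triangular cactus $C$ in $H$ with at least $\tfrac{t}{2}$ triangles such that $x$ and $y$ are in different components of $C$. (2) If $t$ is odd, then there is a triangular cactus $C$ in $H$ with at least $\lceil \tfrac{t}{2}\rceil$ triangles, and for every outeredge $xy$ of $H$ there is a triangular cactus $C$ in $H$ with at least $\lfloor \tfrac{t}{2}\rfloor$ triangles such that $x$ and $y$ are in different components of $C$.
   Context: All graphs are finite and simple. A plane graph is a planar graph together with a fixed crossing-free embedding in the plane; its faces are the connected regions of the complement of the drawing, the outer face being the unbounded one and all others being inner faces. An outerplane graph is a plane graph in which every vertex lies on the boundary of the outer face. An outeredge is an edge on the boundary of the outer face; other edges are inneredges. A triangle is a cycle of length $3$; an inner triangle of $H$ is a triangle that is the boundary of an inner face of $H$. A triangular cactus is a graph all of whose cycles (if any) are triangles and in which every edge lies on some cycle (the graph with no edges is allowed); a triangular cactus in $H$ is a subgraph of $H$ that is a triangular cactus, and its number of triangles is the number of its cycles. "$x$ and $y$ are in different components of $C$" means no connected component of $C$ contains both $x$ and $y$ (this holds in particular if $x$ or $y$ is not a vertex of $C$). -}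

module Defs where

open import Data.Nat using (ℕ; zero; suc; _≤_; _<ᵇ_; _%_)
open import Data.Fin using (Fin; toℕ)
open import Data.Bool using (Bool; true; false; _∧_)
open import Data.List using (List; []; _∷_; length; filterᵇ; concatMap; map; allFin)
open import Data.List.Relation.Unary.Unique.Propositional using (Unique)
open import Data.Product using (_×_; _,_; ∃)
open import Data.Sum using (_⊎_)
open import Data.Unit using (⊤)
open import Relation.Binary.PropositionalEquality using (_≡_)
open import Relation.Binary.Construct.Closure.ReflexiveTransitive using (Star)
open import Relation.Nullary using (¬_)

record Graph (n : ℕ) : Set where
  field
    adj    : Fin n → Fin n → Bool
    sym    : ∀ i j → adj i j ≡ adj j i
    irrefl : ∀ i → adj i i ≡ false
open Graph public

Edge : ∀ {n} → Graph n → Fin n → Fin n → Set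
Edge G a b = adj G a b ≡ true

-- Subgraph (on the same vertex set; vertices of H missing from C are
-- harmless since they are isolated in C and thus separated from everything).
_⊆ᴳ_ : ∀ {n} → Graph n → Graph n → Set
C ⊆ᴳ H = ∀ a b → Edge C a b → Edge H a b

Chain : ∀ {n} → Graph n → List (Fin n) → Set
Chain G []           = ⊤
Chain G (x ∷ [])     = ⊤
Chain G (x ∷ y ∷ r)  = Edge G x y × Chain G (y ∷ r)

lastOf : ∀ {A : Set} → A → List A → A
lastOf x []      = x
lastOf x (y ∷ r) = lastOf y r

IsCycle : ∀ {n} → Graph n → List (Fin n) → Set
IsCycle G []       = Data.Empty.⊥
  where import Data.Empty
IsCycle G (x ∷ r)  =
  Unique (x ∷ r) × (3 ≤ length (x ∷ r)) × Chain G (x ∷ r) × Edge G (lastOf x r) x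

-- Triangular cactus: every cycle is a triangle and every edge lies on a
-- cycle (any cycle through the edge ab can be written starting a, b).
IsTriangularCactus : ∀ {n} → Graph n → Set
IsTriangularCactus C =
  (∀ vs → IsCycle C vs → length vs ≡ 3) ×
  (∀ a b → Edge C a b → ∃ λ vs → IsCycle C (a ∷ b ∷ vs))

triples : (n : ℕ) → List (Fin n × Fin n × Fin n)
triples n = concatMap (λ a → concatMap (λ b → map (λ c → (a , b , c)) (allFin n)) (allFin n)) (allFin n)

isTriangle : ∀ {n} → Graph n → Fin n × Fin n × Fin n → Bool
isTriangle G (a , b , c) =
  (toℕ a <ᵇ toℕ b) ∧ (toℕ b <ᵇ toℕ c) ∧ adj G a b ∧ adj G b c ∧ adj G a c

numTriangles : ∀ {n} → Graph n → ℕ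
numTriangles {n} G = length (filterᵇ (isTriangle G) (triples n))

-- Biconnected outerplane graphs, combinatorially: vertices 0,1,…,n-1
-- (n ≥ 3) listed in order along the outer face boundary, which is the
-- Hamiltonian cycle 0-1-…-(n-1)-0; the remaining edges (chords) are
-- drawn inside and pairwise non-crossing.

OuterPair : (n : ℕ) → Fin n → Fin n → Set
OuterPair n x y =
  (suc (toℕ x) ≡ toℕ y) ⊎ (suc (toℕ y) ≡ toℕ x) ⊎
  ((toℕ x ≡ 0) × (suc (toℕ y) ≡ n)) ⊎ ((toℕ y ≡ 0) × (suc (toℕ x) ≡ n))

NonCrossing : ∀ {n} → Graph n → Set
NonCrossing {n} G = ∀ (a b c d : Fin n) →
  toℕ a Data.Nat.< toℕ b → toℕ b Data.Nat.< toℕ c → toℕ c Data.Nat.< toℕ d →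
  Edge G a c → Edge G b d → Data.Empty.⊥
  where import Data.Empty

record BiconnectedOuterplane {n : ℕ} (H : Graph n) : Set where
  field
    atLeast3    : 3 ≤ n
    outerCycle  : ∀ x y → OuterPair n x y → Edge H x y
    nonCrossing : NonCrossing H

Outeredge : ∀ {n} → Graph n → Fin n → Fin n → Set
Outeredge {n} H x y = Edge H x y × OuterPair n x y

-- Inner triangles: in this drawing every triangle of H bounds an inner
-- face, so they are counted as triangles of H.
innerTriangles : ∀ {n} → Graph n → ℕ
innerTriangles H = numTriangles H

DifferentComponents : ∀ {n} → Graph n → Fin n → Fin n → Set
DifferentComponents C x y = ¬ Star (Edge C) x y

CactusIn : ∀ {n} → Graph n → Graph n → ℕ → Set
CactusIn H C k = (C ⊆ᴳ H) × IsTriangularCactus C × (k ≤ numTriangles C)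

-- Number the vertices 0, 1, …, m along the outer cycle so that the chosen outeredge joins
-- positions m and 0. For positions a < c, induction on c − a yields a list covering the
-- triangles of H on positions [a, c], a cactus on [a, c] with at least half of them (rounded
-- up), and two vertex-disjoint cacti, on [a, c⟩ and on ⟨a, c], with at least half of them
-- (rounded down) in total. For the step let b be the last neighbour of a before c: as chords
-- do not cross, every triangle on [a, c] lies on [a, b], lies on [b, c], or is abc. The cacti
-- for [a, b] and [b, c] meet only in b and are glued there; when abc is a triangle it links
-- the four disjoint parts into one cactus, which pays for the extra triangle. On [0, m] the two
-- disjoint parts separate the ends of the outeredge.
--
-- A cactus is kept as the list of its triangles, assembled by gluing lists that share at most
-- one vertex; a cycle cannot cross such a cut vertex, so all its cycles are triangles.

module Submission where

open import Defs
open import Data.Nat using (ℕ; _%_; ⌊_/2⌋; ⌈_/2⌉)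
open import Data.Fin using (Fin)
open import Data.Product using (_×_; ∃)
open import Relation.Binary.PropositionalEquality using (_≡_)

open import Level using (0ℓ)
open import Function using (id; _∘_; mk⇔; Equivalence)
open import Data.Bool using (Bool; true; false; T; T?; _∧_)
open import Data.Bool.Properties using (T-≡; T-∧)
import Data.Bool.Properties as Bool
open import Data.Empty using (⊥; ⊥-elim)
open import Data.Unit using (⊤; tt)
open import Data.Nat using (zero; suc; _+_; _≤_; _<_; z≤n; s≤s; _<?_; _≤?_)
open import Data.Nat.Properties
  using (≤-refl; ≤-trans; ≤-reflexive; ≤-antisym; ≤-pred; <⇒≤; <-trans; <-≤-trans; ≤-<-trans; <-irrefl; <-asym;
         <⇒≱; ≰⇒>; <-cmp; m≤n⇒m<n∨m≡n; m≤n⇒m≤1+n; suc-injective; <⇒<ᵇ; <ᵇ⇒<;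
         +-mono-≤; +-monoˡ-≤; +-monoʳ-≤; +-assoc; +-suc; +-identityʳ; ⌊n/2⌋≤⌈n/2⌉; ⌊n/2⌋-mono; ⌈n/2⌉-mono)
open import Data.Nat.DivMod using (_mod_; m≤n⇒m%n≡m)
open import Data.Nat.Solver using (module +-*-Solver)
import Data.Fin as Fin
import Data.Fin.Properties as Fin
open import Data.Product using (_,_; proj₁; proj₂)
import Data.Product as Product
open import Data.Sum using (_⊎_; inj₁; inj₂; [_,_]′)
import Data.Sum as Sum
open import Data.List using (List; []; _∷_; [_]; _++_; length; map; concatMap; filterᵇ; allFin)
open import Data.List.Properties using (length-++; length-++-sucʳ; ++-identityʳ; ++-assoc)
open import Data.List.Membership.Propositional using (_∈_; _∉_; lose; find)
open import Data.List.Membership.Propositional.Properties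
  using (∈-∃++; ∈-++⁻; ∈-++⁺ˡ; ∈-++⁺ʳ; ∈-map⁺; ∈-map⁻; ∈-allFin; ∈-concatMap⁺; ∈-concatMap⁻; ∈-filter⁺; ∈-filter⁻)
open import Data.List.Relation.Binary.Disjoint.Propositional using (Disjoint)
open import Data.List.Relation.Binary.Subset.Propositional using (_⊆_)
import Data.List.Relation.Binary.Permutation.Setoid.Properties as Permutation
open import Data.List.Relation.Unary.All using (All; []; _∷_)
import Data.List.Relation.Unary.All as All
import Data.List.Relation.Unary.All.Properties as All
open import Data.List.Relation.Unary.AllPairs using (AllPairs; []; _∷_)
import Data.List.Relation.Unary.AllPairs as AllPairs
import Data.List.Relation.Unary.AllPairs.Properties as AllPairs
open import Data.List.Relation.Unary.Any using (Any; here; there; any?)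
import Data.List.Relation.Unary.Any as Any
import Data.List.Relation.Unary.Any.Properties as Any
open import Data.List.Relation.Unary.Unique.Propositional using (Unique)
import Data.List.Relation.Unary.Unique.Propositional.Properties as Unique
open import Relation.Binary using (Rel; Trichotomous; tri<; tri≈; tri>)
import Relation.Binary.Construct.On as On
open import Relation.Binary.Construct.Closure.ReflexiveTransitive using (fold; reverse)
open import Relation.Binary.PropositionalEquality using (_≢_; refl; trans; cong; cong₂; subst; subst₂)
import Relation.Binary.PropositionalEquality as ≡
open import Relation.Nullary using (¬_; Dec; yes; no; does; ¬?)
open import Relation.Nullary.Decidable using (_×-dec_; dec-true; dec-false; does-⇔)
open import Relation.Nullary.Reflects using (Reflects; invert)
open import Relation.Unary using (Pred; _∪_; ｛_｝)

module _ {A B : Set} (R : A → B → Set) where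

  Separated : A → A → Set
  Separated x x′ = ∀ {y} → R x y → R x′ y → ⊥

  length-≤-of-cover : ∀ {xs ys} → AllPairs Separated xs →
                      (∀ {x} → x ∈ xs → ∃ λ y → y ∈ ys × R x y) → length xs ≤ length ys
  length-≤-of-cover {[]}     _             _     = z≤n
  length-≤-of-cover {x ∷ xs} (x-sep ∷ sep) cover with cover (here refl)
  ... | y , y∈ys , Rxy with ∈-∃++ y∈ys
  ... | ys₁ , ys₂ , refl =
    ≤-trans (s≤s (length-≤-of-cover sep cover′)) (≤-reflexive (≡.sym (length-++-sucʳ ys₁ y ys₂)))
    where
    cover′ : ∀ {x′} → x′ ∈ xs → ∃ λ y′ → y′ ∈ ys₁ ++ ys₂ × R x′ y′
    cover′ x′∈xs with cover (there x′∈xs)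
    ... | y′ , y′∈ys , Rx′y′ with ∈-++⁻ ys₁ y′∈ys
    ...   | inj₁ y′∈ys₁         = y′ , ∈-++⁺ˡ y′∈ys₁ , Rx′y′
    ...   | inj₂ (here refl)    = ⊥-elim (All.lookup x-sep x′∈xs Rxy Rx′y′)
    ...   | inj₂ (there y′∈ys₂) = y′ , ∈-++⁺ʳ ys₁ y′∈ys₂ , Rx′y′

unique-length-≤ : ∀ {A : Set} {xs ys : List A} → Unique xs → xs ⊆ ys → length xs ≤ length ys
unique-length-≤ xs! xs⊆ys =
  length-≤-of-cover _≡_ (AllPairs.map (λ x≢x′ → λ { refl refl → x≢x′ refl }) xs!) (λ x∈xs → _ , xs⊆ys x∈xs , refl)

module _ {A : Set} {_≈_ _<_ : Rel A 0ℓ} (compare : Trichotomous _≈_ _<_) where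

  wlog-sorted : (P : A → A → A → Set) →
                (∀ {x y z} → P x y z → P y x z) → (∀ {x y z} → P x y z → P x z y) →
                (∀ {x y z} → x < y → y < z → P x y z) →
                ∀ {x y z} → ¬ x ≈ y → ¬ y ≈ z → ¬ x ≈ z → P x y z
  wlog-sorted P swap₁₂ swap₂₃ sorted {x} {y} {z} x≉y y≉z x≉z with compare x y | compare y z | compare x z
  ... | tri≈ _ x≈y _ | _            | _            = ⊥-elim (x≉y x≈y)
  ... | _            | tri≈ _ y≈z _ | _            = ⊥-elim (y≉z y≈z)
  ... | _            | _            | tri≈ _ x≈z _ = ⊥-elim (x≉z x≈z)
  ... | tri< x<y _ _ | tri< y<z _ _ | _            = sorted x<y y<z
  ... | tri< x<y _ _ | tri> _ _ z<y | tri< x<z _ _ = swap₂₃ (sorted x<z z<y)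
  ... | tri< x<y _ _ | tri> _ _ z<y | tri> _ _ z<x = swap₂₃ (swap₁₂ (sorted z<x x<y))
  ... | tri> _ _ y<x | tri< y<z _ _ | tri< x<z _ _ = swap₁₂ (sorted y<x x<z)
  ... | tri> _ _ y<x | tri< y<z _ _ | tri> _ _ z<x = swap₁₂ (swap₂₃ (sorted y<z z<x))
  ... | tri> _ _ y<x | tri> _ _ z<y | _            = swap₁₂ (swap₂₃ (swap₁₂ (sorted z<y y<x)))

Triple : ℕ → Set
Triple n = Fin n × Fin n × Fin n

module _ {n : ℕ} where

  infix 4 _∈₃_ _≈₃_

  data _∈₃_ : Fin n → Triple n → Set where
    1st : ∀ {x y z} → x ∈₃ (x , y , z)
    2nd : ∀ {x y z} → y ∈₃ (x , y , z)
    3rd : ∀ {x y z} → z ∈₃ (x , y , z)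

  vertices : Triple n → List (Fin n)
  vertices (x , y , z) = x ∷ y ∷ z ∷ []

  ∈₃⇒∈-vertices : ∀ {w t} → w ∈₃ t → w ∈ vertices t
  ∈₃⇒∈-vertices 1st = here refl
  ∈₃⇒∈-vertices 2nd = there (here refl)
  ∈₃⇒∈-vertices 3rd = there (there (here refl))

  _⊆₃_ : Triple n → Triple n → Set
  s ⊆₃ t = ∀ {w} → w ∈₃ s → w ∈₃ t

  _≈₃_ : Triple n → Triple n → Set
  s ≈₃ t = s ⊆₃ t × t ⊆₃ s

  ≈₃-refl : ∀ {t} → t ≈₃ t
  ≈₃-refl = id , id

  ≈₃-sym : ∀ {s t} → s ≈₃ t → t ≈₃ s
  ≈₃-sym (s⊆t , t⊆s) = t⊆s , s⊆t

  ≈₃-trans : ∀ {s t u} → s ≈₃ t → t ≈₃ u → s ≈₃ u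
  ≈₃-trans (s⊆t , t⊆s) (t⊆u , u⊆t) = (λ w∈s → t⊆u (s⊆t w∈s)) , (λ w∈u → t⊆s (u⊆t w∈u))

  swap₁₂ : ∀ {x y z} → (x , y , z) ≈₃ (y , x , z)
  swap₁₂ = swap , swap
    where
    swap : ∀ {x y z w} → w ∈₃ (x , y , z) → w ∈₃ (y , x , z)
    swap 1st = 2nd
    swap 2nd = 1st
    swap 3rd = 3rd

  swap₂₃ : ∀ {x y z} → (x , y , z) ≈₃ (x , z , y)
  swap₂₃ = swap , swap
    where
    swap : ∀ {x y z w} → w ∈₃ (x , y , z) → w ∈₃ (x , z , y)
    swap 1st = 1st
    swap 2nd = 3rd
    swap 3rd = 2nd

  Distinct₃ : Triple n → Set
  Distinct₃ (x , y , z) = x ≢ y × y ≢ z × x ≢ z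

  third-vertex : ∀ {t u w} → Distinct₃ t → u ∈₃ t → w ∈₃ t → u ≢ w →
                 ∃ λ v → v ∈₃ t × u ≢ v × w ≢ v
  third-vertex _                   1st 1st u≢w = ⊥-elim (u≢w refl)
  third-vertex _                   2nd 2nd u≢w = ⊥-elim (u≢w refl)
  third-vertex _                   3rd 3rd u≢w = ⊥-elim (u≢w refl)
  third-vertex (x≢y , y≢z , x≢z) 1st 2nd _   = _ , 3rd , x≢z , y≢z
  third-vertex (x≢y , y≢z , x≢z) 2nd 1st _   = _ , 3rd , y≢z , x≢z
  third-vertex (x≢y , y≢z , x≢z) 1st 3rd _   = _ , 2nd , x≢y , y≢z ∘ ≡.sym
  third-vertex (x≢y , y≢z , x≢z) 3rd 1st _   = _ , 2nd , y≢z ∘ ≡.sym , x≢y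
  third-vertex (x≢y , y≢z , x≢z) 2nd 3rd _   = _ , 1st , x≢y ∘ ≡.sym , x≢z ∘ ≡.sym
  third-vertex (x≢y , y≢z , x≢z) 3rd 2nd _   = _ , 1st , x≢z ∘ ≡.sym , x≢y ∘ ≡.sym

  Sorted : Triple n → Set
  Sorted (x , y , z) = x Fin.< y × y Fin.< z

  sorted-distinct : ∀ {t} → Sorted t → Distinct₃ t
  sorted-distinct (x<y , y<z) =
    Fin.<⇒≢ x<y , Fin.<⇒≢ y<z , Fin.<⇒≢ (Fin.<-trans x<y y<z)

  private
    first-≤ : ∀ {t w} → Sorted t → w ∈₃ t → proj₁ t Fin.≤ w
    first-≤ _             1st = Fin.≤-refl
    first-≤ (x<y , _)     2nd = <⇒≤ x<y
    first-≤ (x<y , y<z)   3rd = <⇒≤ (Fin.<-trans x<y y<z)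

    ≤-last : ∀ {t w} → Sorted t → w ∈₃ t → w Fin.≤ proj₂ (proj₂ t)
    ≤-last (x<y , y<z)   1st = <⇒≤ (Fin.<-trans x<y y<z)
    ≤-last (_ , y<z)     2nd = <⇒≤ y<z
    ≤-last _             3rd = Fin.≤-refl

  sorted-≈₃⇒≡ : ∀ {s t} → Sorted s → Sorted t → s ≈₃ t → s ≡ t
  sorted-≈₃⇒≡ {x , y , z} s↑ t↑ (s⊆t , t⊆s)
    with Fin.≤-antisym (first-≤ s↑ (t⊆s 1st)) (first-≤ t↑ (s⊆t 1st))
       | Fin.≤-antisym (≤-last t↑ (s⊆t 3rd)) (≤-last s↑ (t⊆s 3rd))
  ... | refl | refl with s⊆t (2nd {x} {y} {z})
  ...   | 1st = ⊥-elim (Fin.<-irrefl refl (proj₁ s↑))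
  ...   | 2nd = refl
  ...   | 3rd = ⊥-elim (Fin.<-irrefl refl (proj₂ s↑))

  sorted-rearrangement : ∀ {t} → Distinct₃ t → ∃ λ s → Sorted s × s ≈₃ t
  sorted-rearrangement {x , y , z} (x≢y , y≢z , x≢z) =
    wlog-sorted Fin.<-cmp (λ x y z → ∃ λ s → Sorted s × s ≈₃ (x , y , z))
      (λ (s , s↑ , s≈) → s , s↑ , ≈₃-trans s≈ swap₁₂)
      (λ (s , s↑ , s≈) → s , s↑ , ≈₃-trans s≈ swap₂₃)
      (λ x<y y<z → _ , (x<y , y<z) , ≈₃-refl)
      x≢y y≢z x≢z

module _ {n : ℕ} (G : Graph n) where

  edge-sym : ∀ {x y} → Edge G x y → Edge G y x
  edge-sym {x} {y} e = trans (Graph.sym G y x) e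

  edge⇒≢ : ∀ {x y} → Edge G x y → x ≢ y
  edge⇒≢ {x} e refl with trans (≡.sym e) (irrefl G x)
  ... | ()

  Triangle : Triple n → Set
  Triangle (x , y , z) = Edge G x y × Edge G y z × Edge G x z

  triangle-distinct : ∀ {t} → Triangle t → Distinct₃ t
  triangle-distinct (xy , yz , xz) = edge⇒≢ xy , edge⇒≢ yz , edge⇒≢ xz

  triangle-edge : ∀ {t u w} → Triangle t → u ∈₃ t → w ∈₃ t → u ≢ w → Edge G u w
  triangle-edge _              1st 1st u≢w = ⊥-elim (u≢w refl)
  triangle-edge _              2nd 2nd u≢w = ⊥-elim (u≢w refl)
  triangle-edge _              3rd 3rd u≢w = ⊥-elim (u≢w refl)
  triangle-edge (xy , yz , xz) 1st 2nd _   = xy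
  triangle-edge (xy , yz , xz) 2nd 3rd _   = yz
  triangle-edge (xy , yz , xz) 1st 3rd _   = xz
  triangle-edge (xy , yz , xz) 2nd 1st _   = edge-sym xy
  triangle-edge (xy , yz , xz) 3rd 2nd _   = edge-sym yz
  triangle-edge (xy , yz , xz) 3rd 1st _   = edge-sym xz

module _ {n : ℕ} where

  triples-complete : ∀ t → t ∈ triples n
  triples-complete (x , y , z) =
    ∈-concatMap⁺ _ (lose (∈-allFin x) (∈-concatMap⁺ _ (lose (∈-allFin y) (∈-map⁺ _ (∈-allFin z)))))

  private
    concatMap-unique : ∀ {A B : Set} (f : A → List B) (key : B → A) {xs} →
                       (∀ {x v} → v ∈ f x → key v ≡ x) →
                       Unique xs → (∀ x → Unique (f x)) → Unique (concatMap f xs)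
    concatMap-unique f key key-f xs! f! =
      Unique.concat⁺ (All.map⁺ (All.tabulate λ _ → f! _)) (AllPairs.map⁺ (AllPairs.map disjoint xs!))
      where
      disjoint : ∀ {x x′} → x ≢ x′ → Disjoint (f x) (f x′)
      disjoint x≢x′ (v∈fx , v∈fx′) = x≢x′ (trans (≡.sym (key-f v∈fx)) (key-f v∈fx′))

  triples-unique : Unique (triples n)
  triples-unique =
    concatMap-unique _ proj₁ first (Unique.allFin⁺ n) λ _ →
    concatMap-unique _ (proj₁ ∘ proj₂) second (Unique.allFin⁺ n) λ _ →
    Unique.map⁺ (cong (proj₂ ∘ proj₂)) (Unique.allFin⁺ n)
    where
    second : ∀ {x y : Fin n} {v : Triple n} → v ∈ map (λ z → x , y , z) (allFin n) → proj₁ (proj₂ v) ≡ y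
    second v∈ with ∈-map⁻ _ v∈
    ... | _ , _ , refl = refl
    first : ∀ {x : Fin n} {v : Triple n} → v ∈ concatMap (λ y → map (λ z → x , y , z) (allFin n)) (allFin n) → proj₁ v ≡ x
    first {x} v∈ with find (∈-concatMap⁻ (λ y → map (λ z → x , y , z) (allFin n)) {xs = allFin n} v∈)
    ... | y , _ , v∈′ with ∈-map⁻ (λ z → x , y , z) v∈′
    ...   | _ , _ , refl = refl

module _ {n : ℕ} (G : Graph n) where

  trianglesOf : List (Triple n)
  trianglesOf = filterᵇ (isTriangle G) (triples n)

  trianglesOf-unique : Unique trianglesOf
  trianglesOf-unique = Unique.filter⁺ _ triples-unique

  private
    T-∧⁺ : ∀ {a b} → T a → T b → T (a ∧ b)
    T-∧⁺ p q = Equivalence.from T-∧ (p , q)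

    T-∧⁻ : ∀ {a b} → T (a ∧ b) → T a × T b
    T-∧⁻ = Equivalence.to T-∧

    edge⇒T : ∀ {u w} → Edge G u w → T (adj G u w)
    edge⇒T = Equivalence.from T-≡

    T⇒edge : ∀ {u w} → T (adj G u w) → Edge G u w
    T⇒edge = Equivalence.to T-≡

  ∈-trianglesOf⁺ : ∀ {s} → Sorted s → Triangle G s → s ∈ trianglesOf
  ∈-trianglesOf⁺ {x , y , z} (x<y , y<z) (xy , yz , xz) =
    ∈-filter⁺ (T? ∘ isTriangle G) (triples-complete _)
      (T-∧⁺ (<⇒<ᵇ x<y) (T-∧⁺ (<⇒<ᵇ y<z)
        (T-∧⁺ (edge⇒T xy) (T-∧⁺ (edge⇒T yz) (edge⇒T xz)))))

  ∈-trianglesOf⁻ : ∀ {s} → s ∈ trianglesOf → Sorted s × Triangle G s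
  ∈-trianglesOf⁻ {x , y , z} s∈ =
    let x<y , rest  = T-∧⁻ (proj₂ (∈-filter⁻ (T? ∘ isTriangle G) {xs = triples n} s∈))
        y<z , rest′ = T-∧⁻ rest
        xy , rest″  = T-∧⁻ rest′
        yz , xz     = T-∧⁻ rest″
    in (<ᵇ⇒< _ _ x<y , <ᵇ⇒< _ _ y<z) , T⇒edge xy , T⇒edge yz , T⇒edge xz

module _ {n : ℕ} (G : Graph n) where

  NonIsolated : Fin n → Set
  NonIsolated u = ∃ (Edge G u)

  chain-nonIsolated : ∀ {x y r w} → Chain G (x ∷ y ∷ r) → w ∈ x ∷ y ∷ r → NonIsolated w
  chain-nonIsolated           (xy , _) (here refl)         = _ , xy
  chain-nonIsolated           (xy , _) (there (here refl)) = _ , edge-sym G xy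
  chain-nonIsolated {r = z ∷ r} (_ , c) (there (there w∈r)) = chain-nonIsolated c (there w∈r)

  last-nonIsolated : ∀ {x y r} → Chain G (x ∷ y ∷ r) → NonIsolated (lastOf y r)
  last-nonIsolated {r = []}    (xy , _) = _ , edge-sym G xy
  last-nonIsolated {r = z ∷ r} (_ , c)  = last-nonIsolated c

  cycle-nonIsolated : ∀ {vs w} → IsCycle G vs → w ∈ vs → NonIsolated w
  cycle-nonIsolated {_ ∷ []}    (_ , s≤s () , _)
  cycle-nonIsolated {_ ∷ _ ∷ _} (_ , _ , c , _) = chain-nonIsolated c

  ClosedWalk : List (Fin n) → Set
  ClosedWalk []      = ⊤
  ClosedWalk (x ∷ r) = Chain G (x ∷ r) × Edge G (lastOf x r) x

  cycle-parts : ∀ {vs} → IsCycle G vs → Unique vs × 3 ≤ length vs × ClosedWalk vs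
  cycle-parts {_ ∷ _} c = c

  private
    lastOf-snoc : ∀ (x : Fin n) r y → lastOf x (r ++ [ y ]) ≡ y
    lastOf-snoc x []      y = refl
    lastOf-snoc x (z ∷ r) y = lastOf-snoc z r y

    chain-snoc : ∀ x r {y} → Chain G (x ∷ r) → Edge G (lastOf x r) y → Chain G (x ∷ r ++ [ y ])
    chain-snoc x []      _        e = e , tt
    chain-snoc x (z ∷ r) (xz , c) e = xz , chain-snoc z r c e

    closedWalk-rotate₁ : ∀ x r → ClosedWalk (x ∷ r) → ClosedWalk (r ++ [ x ])
    closedWalk-rotate₁ x []      w                    = w
    closedWalk-rotate₁ x (y ∷ r) ((xy , c) , closing) =
      chain-snoc y r c closing , subst (λ u → Edge G u y) (≡.sym (lastOf-snoc y r x)) xy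

  closedWalk-rotate : ∀ xs {v ys} → ClosedWalk (xs ++ v ∷ ys) → ClosedWalk (v ∷ ys ++ xs)
  closedWalk-rotate []       {v} {ys} w = subst (λ l → ClosedWalk (v ∷ l)) (≡.sym (++-identityʳ ys)) w
  closedWalk-rotate (x ∷ xs) {v} {ys} w =
    subst (λ l → ClosedWalk (v ∷ l)) (++-assoc ys [ x ] xs)
      (closedWalk-rotate xs (subst ClosedWalk (++-assoc xs (v ∷ ys) [ x ]) (closedWalk-rotate₁ x (xs ++ v ∷ ys) w)))

  cycle-rotate : ∀ xs {v ys} → IsCycle G (xs ++ v ∷ ys) → IsCycle G (v ∷ ys ++ xs)
  cycle-rotate xs {v} {ys} c =
    let unique , long , walk = cycle-parts c
    in ↭.Unique-resp-↭ rotation unique , subst (3 ≤_) (↭.xs↭ys⇒|xs|≡|ys| rotation) long , closedWalk-rotate xs walk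
    where
    module ↭ = Permutation (≡.setoid (Fin n))
    rotation = ↭.++-comm xs (v ∷ ys)

-- Cycles and components of a union of two graphs

module Union {n : ℕ} (G₁ G₂ G : Graph n)
             (edge-split : ∀ {u w} → Edge G u w → Edge G₁ u w ⊎ Edge G₂ u w) where

  open import Data.List.Membership.DecPropositional (Fin._≟_ {n}) using (_∈?_)
  private module ↭ = Permutation (≡.setoid (Fin n))

  disjoint-separates : (∀ {u} → NonIsolated G₁ u → NonIsolated G₂ u → ⊥) →
                       ∀ {x y} → ¬ NonIsolated G₂ x → ¬ NonIsolated G₁ y → x ≢ y →
                       DifferentComponents G x y
  disjoint-separates disjoint {x} x∉G₂ y∉G₁ x≢y path =
    [ x≢y , y∉G₁ ]′ (fold (λ u w → Reached u → Reached w) (λ e f → f ∘ step e) (λ r → r) path (inj₁ refl))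
    where
    Reached : Fin n → Set
    Reached w = x ≡ w ⊎ NonIsolated G₁ w
    step : ∀ {u w} → Edge G u w → Reached u → Reached w
    step e reached with edge-split e | reached
    ... | inj₁ e₁ | _         = inj₂ (_ , edge-sym G₁ e₁)
    ... | inj₂ e₂ | inj₁ refl = ⊥-elim (x∉G₂ (_ , e₂))
    ... | inj₂ e₂ | inj₂ u∈G₁ = ⊥-elim (disjoint u∈G₁ (_ , e₂))

  module _ (v : Fin n) (cut : ∀ {u} → NonIsolated G₁ u → NonIsolated G₂ u → u ≡ v) where

    private
      side : Bool → Graph n
      side true  = G₁
      side false = G₂

      edge-side : ∀ {u w} → Edge G u w → ∃ λ i → Edge (side i) u w
      edge-side e = [ (λ e₁ → true , e₁) , (λ e₂ → false , e₂) ]′ (edge-split e)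

      same-side : ∀ {u} i j → v ≢ u → NonIsolated (side i) u → NonIsolated (side j) u → i ≡ j
      same-side true  true  _   _  _  = refl
      same-side false false _   _  _  = refl
      same-side true  false v≢u u₁ u₂ = ⊥-elim (v≢u (≡.sym (cut u₁ u₂)))
      same-side false true  v≢u u₂ u₁ = ⊥-elim (v≢u (≡.sym (cut u₁ u₂)))

      chain-side : ∀ {x y r} → Chain G (x ∷ y ∷ r) → All (v ≢_) (y ∷ r) → ∃ λ i → Chain (side i) (x ∷ y ∷ r)
      chain-side {r = []}    (xy , _) _ = let i , xy′ = edge-side xy in i , xy′ , tt
      chain-side {r = z ∷ r} (xy , c) (v≢y ∷ v∉r) with edge-side xy | chain-side c v∉r
      ... | i , xy′ | j , c′ with same-side i j v≢y (_ , edge-sym (side i) xy′) (_ , proj₁ c′)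
      ...   | refl = i , xy′ , c′

      lastOf-∈ : ∀ (x : Fin n) r → lastOf x r ∈ x ∷ r
      lastOf-∈ x []      = here refl
      lastOf-∈ x (y ∷ r) = there (lastOf-∈ y r)

      cycle-side : ∀ {x r} → IsCycle G (x ∷ r) → All (v ≢_) r → ∃ λ i → IsCycle (side i) (x ∷ r)
      cycle-side {r = []}    (_ , s≤s () , _)
      cycle-side {r = y ∷ r} (unique , long , c , closing) v∉r with chain-side c v∉r | edge-side closing
      ... | i , c′ | j , closing′
        with same-side i j (All.lookup v∉r (lastOf-∈ y r)) (last-nonIsolated (side i) c′) (_ , closing′)
      ...   | refl = i , unique , long , c′ , closing′

      avoiding-side : ∀ {vs} → v ∉ vs → IsCycle G vs → ∃ λ i → IsCycle (side i) vs
      avoiding-side {x ∷ r} v∉vs c = cycle-side c (All.¬Any⇒All¬ r (v∉vs ∘ there))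

      as-union : ∀ {vs} → (∃ λ i → IsCycle (side i) vs) → IsCycle G₁ vs ⊎ IsCycle G₂ vs
      as-union (true  , c) = inj₁ c
      as-union (false , c) = inj₂ c

    -- Consecutive edges of a cycle meet in a vertex other than v, so they lie in the same
    -- graph; a cycle through v is first rotated to start at v.
    cycle-of-union : ∀ {vs} → IsCycle G vs →
                     ∃ λ vs′ → length vs′ ≡ length vs × (IsCycle G₁ vs′ ⊎ IsCycle G₂ vs′)
    cycle-of-union {vs} c with v ∈? vs
    ... | no v∉vs = vs , refl , as-union (avoiding-side v∉vs c)
    ... | yes v∈vs with ∈-∃++ v∈vs
    ...   | xs , ys , refl =
      let rotated = cycle-rotate G xs c
      in v ∷ ys ++ xs , ↭.xs↭ys⇒|xs|≡|ys| (↭.++-comm (v ∷ ys) xs) ,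
         as-union (cycle-side rotated (AllPairs.head (proj₁ rotated)))

-- Trees of triangles

module _ {n : ℕ} where

  Touches : List (Triple n) → Fin n → Set
  Touches L w = Any (w ∈₃_) L

  Spans : List (Triple n) → Fin n → Fin n → Set
  Spans L u w = Any (λ t → u ∈₃ t × w ∈₃ t) L

  _∈₃?_ : ∀ (w : Fin n) t → Dec (w ∈₃ t)
  w ∈₃? (x , y , z) with w Fin.≟ x | w Fin.≟ y | w Fin.≟ z
  ... | yes refl | _        | _        = yes 1st
  ... | _        | yes refl | _        = yes 2nd
  ... | _        | _        | yes refl = yes 3rd
  ... | no w≢x   | no w≢y   | no w≢z   = no λ { 1st → w≢x refl ; 2nd → w≢y refl ; 3rd → w≢z refl }

  adjacent? : ∀ L u w → Dec (u ≢ w × Spans L u w)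
  adjacent? L u w = ¬? (u Fin.≟ w) ×-dec any? (λ t → (u ∈₃? t) ×-dec (w ∈₃? t)) L

  triangleGraph : List (Triple n) → Graph n
  triangleGraph L = record
    { adj    = λ u w → does (adjacent? L u w)
    ; sym    = λ u w → does-⇔ (mk⇔ flip flip) (adjacent? L u w) (adjacent? L w u)
    ; irrefl = λ u → dec-false (adjacent? L u u) λ (u≢u , _) → u≢u refl
    }
    where
    flip : ∀ {u w} → u ≢ w × Spans L u w → w ≢ u × Spans L w u
    flip (u≢w , s) = u≢w ∘ ≡.sym , Any.map Product.swap s

  module _ {L : List (Triple n)} {u w : Fin n} where

    edge⁺ : u ≢ w → Spans L u w → Edge (triangleGraph L) u w
    edge⁺ u≢w s = dec-true (adjacent? L u w) (u≢w , s)

    edge⁻ : Edge (triangleGraph L) u w → u ≢ w × Spans L u w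
    edge⁻ e = invert (subst (Reflects _) e (Dec.proof (adjacent? L u w)))

  nonIsolated⇒touches : ∀ {L u} → NonIsolated (triangleGraph L) u → Touches L u
  nonIsolated⇒touches (_ , e) = Any.map proj₁ (proj₂ (edge⁻ e))

  edge-++ : ∀ L₁ {L₂ u w} → Edge (triangleGraph (L₁ ++ L₂)) u w →
            Edge (triangleGraph L₁) u w ⊎ Edge (triangleGraph L₂) u w
  edge-++ L₁ e with edge⁻ e
  ... | u≢w , s = Sum.map (edge⁺ u≢w) (edge⁺ u≢w) (Any.++⁻ L₁ s)

  edge-in-triangle : ∀ {L t u w} → t ∈ L → u ∈₃ t → w ∈₃ t → u ≢ w → Edge (triangleGraph L) u w
  edge-in-triangle t∈L u∈t w∈t u≢w = edge⁺ u≢w (lose t∈L (u∈t , w∈t))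

  listed-triangle : ∀ {L t s} → t ∈ L → s ⊆₃ t → Distinct₃ s → Triangle (triangleGraph L) s
  listed-triangle {s = _ , _ , _} t∈L s⊆t (x≢y , y≢z , x≢z) =
    edge-in-triangle t∈L (s⊆t 1st) (s⊆t 2nd) x≢y ,
    edge-in-triangle t∈L (s⊆t 2nd) (s⊆t 3rd) y≢z ,
    edge-in-triangle t∈L (s⊆t 1st) (s⊆t 3rd) x≢z

  triangleGraph-⊆ : ∀ {H L} → All (Triangle H) L → triangleGraph L ⊆ᴳ H
  triangleGraph-⊆ {H} triangles a b e with edge⁻ e
  ... | a≢b , s with find s
  ...   | t , t∈L , a∈t , b∈t = triangle-edge H (All.lookup triangles t∈L) a∈t b∈t a≢b

  edge-on-triangle : ∀ {L} → All Distinct₃ L → ∀ a b → Edge (triangleGraph L) a b →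
                     ∃ λ vs → IsCycle (triangleGraph L) (a ∷ b ∷ vs)
  edge-on-triangle distinct a b e with edge⁻ e
  ... | a≢b , s with find s
  ...   | t , t∈L , a∈t , b∈t with third-vertex (All.lookup distinct t∈L) a∈t b∈t a≢b
  ...     | c , c∈t , a≢c , b≢c =
    [ c ] , ((a≢b ∷ a≢c ∷ []) ∷ (b≢c ∷ []) ∷ [] ∷ []) , ≤-refl ,
    (edge-in-triangle t∈L a∈t b∈t a≢b , edge-in-triangle t∈L b∈t c∈t b≢c , tt) ,
    edge-in-triangle t∈L c∈t a∈t (a≢c ∘ ≡.sym)

  data TriangleTree : List (Triple n) → Set where
    empty  : TriangleTree []
    single : ∀ {t} → Distinct₃ t → TriangleTree [ t ]
    glue   : ∀ {L₁ L₂} v → (∀ {w} → Touches L₁ w → Touches L₂ w → w ≡ v) →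
             TriangleTree L₁ → TriangleTree L₂ → TriangleTree (L₁ ++ L₂)

  tree-distinct : ∀ {L} → TriangleTree L → All Distinct₃ L
  tree-distinct empty              = []
  tree-distinct (single distinct)  = distinct ∷ []
  tree-distinct (glue _ _ T₁ T₂)   = All.++⁺ (tree-distinct T₁) (tree-distinct T₂)

  tree-cycle-length : ∀ {L vs} → TriangleTree L → IsCycle (triangleGraph L) vs → length vs ≡ 3
  tree-cycle-length {vs = x ∷ _} empty c
    with nonIsolated⇒touches {L = []} {x} (cycle-nonIsolated (triangleGraph []) c (here refl))
  ... | ()
  tree-cycle-length (single {t} _) c =
    let unique , long , _ = cycle-parts (triangleGraph [ t ]) c
    in ≤-antisym (unique-length-≤ unique λ w∈vs →
                   ∈₃⇒∈-vertices (on-triangle (cycle-nonIsolated (triangleGraph [ t ]) c w∈vs)))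
                 long
    where
    on-triangle : ∀ {t w} → NonIsolated (triangleGraph [ t ]) w → w ∈₃ t
    on-triangle {t} w∈ with nonIsolated⇒touches {L = [ t ]} w∈
    ... | here w∈t = w∈t
  tree-cycle-length {L} (glue {L₁} {L₂} v cut T₁ T₂) c
    with Union.cycle-of-union _ _ (triangleGraph L) (edge-++ L₁) v
           (λ u∈₁ u∈₂ → cut (nonIsolated⇒touches u∈₁) (nonIsolated⇒touches u∈₂)) c
  ... | _ , same-length , inj₁ c₁ = trans (≡.sym same-length) (tree-cycle-length T₁ c₁)
  ... | _ , same-length , inj₂ c₂ = trans (≡.sym same-length) (tree-cycle-length T₂ c₂)

  tree-cactus : ∀ {L} → TriangleTree L → IsTriangularCactus (triangleGraph L)
  tree-cactus T = (λ _ → tree-cycle-length T) , edge-on-triangle (tree-distinct T)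

  tree-no-nesting : ∀ {L} → TriangleTree L → AllPairs (λ t t′ → ¬ t ⊆₃ t′) L
  tree-no-nesting empty      = []
  tree-no-nesting (single _) = [] ∷ []
  tree-no-nesting (glue v cut T₁ T₂) =
    AllPairs.++⁺ (tree-no-nesting T₁) (tree-no-nesting T₂)
      (All.tabulate λ t∈L₁ → All.tabulate λ t′∈L₂ t⊆t′ →
         let shared : ∀ {w} → w ∈₃ _ → w ≡ v
             shared w∈t = cut (lose t∈L₁ w∈t) (lose t′∈L₂ (t⊆t′ w∈t))
         in proj₁ (All.lookup (tree-distinct T₁) t∈L₁) (trans (shared 1st) (≡.sym (shared 2nd))))

  tree-count : ∀ {L} → TriangleTree L → length L ≤ numTriangles (triangleGraph L)
  tree-count {L} T = length-≤-of-cover _≈₃_ separated cover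
    where
    separated : AllPairs (Separated _≈₃_) L
    separated = AllPairs.map (λ t⊈t′ {_} (t⊆s , _) (_ , s⊆t′) → t⊈t′ λ w∈t → s⊆t′ (t⊆s w∈t)) (tree-no-nesting T)
    cover : ∀ {t} → t ∈ L → ∃ λ s → s ∈ trianglesOf (triangleGraph L) × t ≈₃ s
    cover t∈L with sorted-rearrangement (All.lookup (tree-distinct T) t∈L)
    ... | s , s↑ , s⊆t , t⊆s =
      s , ∈-trianglesOf⁺ (triangleGraph L) s↑ (listed-triangle t∈L s⊆t (sorted-distinct s↑)) , t⊆s , s⊆t

  separated-by-disjointness : ∀ {L₁ L₂ x y} → (∀ {w} → Touches L₁ w → Touches L₂ w → ⊥) →
                              ¬ Touches L₂ x → ¬ Touches L₁ y → x ≢ y →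
                              DifferentComponents (triangleGraph (L₁ ++ L₂)) x y
  separated-by-disjointness {L₁} {L₂} disjoint x∉L₂ y∉L₁ =
    Union.disjoint-separates (triangleGraph L₁) (triangleGraph L₂) (triangleGraph (L₁ ++ L₂)) (edge-++ L₁)
      (λ u∈₁ u∈₂ → disjoint (nonIsolated⇒touches u∈₁) (nonIsolated⇒touches u∈₂))
      (x∉L₂ ∘ nonIsolated⇒touches) (y∉L₁ ∘ nonIsolated⇒touches)

-- Numberings of the outer cycle

-- The outer cycle read from some starting vertex: position p ≤ m carries the vertex vtx p
-- (positions beyond m carry junk).
record OuterLabelling {m : ℕ} (H : Graph (suc m)) : Set where
  field
    vtx         : ℕ → Fin (suc m)
    injective   : ∀ {p q} → p ≤ m → q ≤ m → vtx p ≡ vtx q → p ≡ q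
    surjective  : ∀ w → ∃ λ p → p ≤ m × vtx p ≡ w
    consecutive : ∀ {p} → p < m → Edge H (vtx p) (vtx (suc p))
    closing     : Edge H (vtx m) (vtx 0)
    nonCrossing : ∀ {a b c d} → a < b → b < c → c < d → d ≤ m →
                  Edge H (vtx a) (vtx c) → Edge H (vtx b) (vtx d) → ⊥

module _ {m : ℕ} {H : Graph (suc m)} (BO : BiconnectedOuterplane H) where

  open OuterLabelling

  private
    toℕ-mod : ∀ {p} → p ≤ m → Fin.toℕ (p mod suc m) ≡ p
    toℕ-mod p≤m = trans (Fin.toℕ-fromℕ< _) (m≤n⇒m%n≡m p≤m)

  standardLabelling : OuterLabelling H
  standardLabelling = record
    { vtx         = _mod suc m
    ; injective   = λ p≤m q≤m e → trans (≡.sym (toℕ-mod p≤m)) (trans (cong Fin.toℕ e) (toℕ-mod q≤m))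
    ; surjective  = λ w → let w≤m = Fin.toℕ≤pred[n] w in
                          Fin.toℕ w , w≤m , Fin.toℕ-injective (toℕ-mod w≤m)
    ; consecutive = λ p<m → outerCycle _ _
                      (inj₁ (trans (cong suc (toℕ-mod (<⇒≤ p<m))) (≡.sym (toℕ-mod p<m))))
    ; closing     = outerCycle _ _ (inj₂ (inj₂ (inj₂ (toℕ-mod z≤n , cong suc (toℕ-mod ≤-refl)))))
    ; nonCrossing = λ a<b b<c c<d d≤m →
        let c≤m = <⇒≤ (<-≤-trans c<d d≤m)
            b≤m = <⇒≤ (<-≤-trans b<c c≤m)
            a≤m = <⇒≤ (<-≤-trans a<b b≤m)
            ordered = λ {p q} p≤m q≤m (p<q : p < q) →
                        subst₂ _<_ (≡.sym (toℕ-mod p≤m)) (≡.sym (toℕ-mod q≤m)) p<q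
        in BiconnectedOuterplane.nonCrossing BO _ _ _ _
             (ordered a≤m b≤m a<b) (ordered b≤m c≤m b<c) (ordered c≤m d≤m c<d)
    }
    where open BiconnectedOuterplane BO using (outerCycle)

  standardLabelling-toℕ : ∀ w → vtx standardLabelling (Fin.toℕ w) ≡ w
  standardLabelling-toℕ w = Fin.toℕ-injective (toℕ-mod (Fin.toℕ≤pred[n] w))

module _ {m : ℕ} {H : Graph (suc m)} (0<m : 0 < m) where

  open OuterLabelling

  module _ (ℓ : OuterLabelling H) where

    private
      next : ℕ → Fin (suc m)
      next p with p <? m
      ... | yes _ = vtx ℓ (suc p)
      ... | no  _ = vtx ℓ 0

    next-< : ∀ {p} → p < m → next p ≡ vtx ℓ (suc p)
    next-< {p} p<m with p <? m
    ... | yes _   = refl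
    ... | no  p≮m = ⊥-elim (p≮m p<m)

    next-m : next m ≡ vtx ℓ 0
    next-m with m <? m
    ... | yes m<m = ⊥-elim (<-irrefl refl m<m)
    ... | no  _   = refl

    private
      next-edge : ∀ {p q} → p < m → q < m → Edge H (vtx ℓ (suc p)) (vtx ℓ (suc q)) → Edge H (next p) (next q)
      next-edge p<m q<m = subst₂ (Edge H) (≡.sym (next-< p<m)) (≡.sym (next-< q<m))

    rotate : OuterLabelling H
    rotate = record
      { vtx         = next
      ; injective   = injective′
      ; surjective  = surjective′
      ; consecutive = consecutive′
      ; closing     = subst₂ (Edge H) (≡.sym next-m) (≡.sym (next-< 0<m)) (consecutive ℓ 0<m)
      ; nonCrossing = nonCrossing′
      }
      where
      injective′ : ∀ {p q} → p ≤ m → q ≤ m → next p ≡ next q → p ≡ q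
      injective′ p≤m q≤m e with m≤n⇒m<n∨m≡n p≤m | m≤n⇒m<n∨m≡n q≤m
      ... | inj₁ p<m | inj₁ q<m =
        suc-injective (injective ℓ p<m q<m (trans (≡.sym (next-< p<m)) (trans e (next-< q<m))))
      ... | inj₁ p<m | inj₂ refl with injective ℓ p<m z≤n (trans (≡.sym (next-< p<m)) (trans e next-m))
      ...   | ()
      injective′ p≤m q≤m e | inj₂ refl | inj₁ q<m
        with injective ℓ q<m z≤n (trans (≡.sym (next-< q<m)) (trans (≡.sym e) next-m))
      ...   | ()
      injective′ p≤m q≤m e | inj₂ refl | inj₂ refl = refl

      surjective′ : ∀ w → ∃ λ p → p ≤ m × next p ≡ w
      surjective′ w with surjective ℓ w
      ... | zero  , _     , v₀≡w = m , ≤-refl , trans next-m v₀≡w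
      ... | suc p , p+1≤m , e    = p , <⇒≤ p+1≤m , trans (next-< p+1≤m) e

      consecutive′ : ∀ {p} → p < m → Edge H (next p) (next (suc p))
      consecutive′ {p} p<m with m≤n⇒m<n∨m≡n p<m
      ... | inj₁ p+1<m = next-edge p<m p+1<m (consecutive ℓ p+1<m)
      ... | inj₂ refl  = subst₂ (Edge H) (≡.sym (next-< p<m)) (≡.sym next-m) (closing ℓ)

      nonCrossing′ : ∀ {a b c d} → a < b → b < c → c < d → d ≤ m →
                     Edge H (next a) (next c) → Edge H (next b) (next d) → ⊥
      nonCrossing′ a<b b<c c<d d≤m ac bd with m≤n⇒m<n∨m≡n d≤m
      ... | inj₁ d<m =
        let c<m = <-trans c<d d<m ; b<m = <-trans b<c c<m ; a<m = <-trans a<b b<m in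
        nonCrossing ℓ (s≤s a<b) (s≤s b<c) (s≤s c<d) d<m
          (subst₂ (Edge H) (next-< a<m) (next-< c<m) ac) (subst₂ (Edge H) (next-< b<m) (next-< d<m) bd)
      ... | inj₂ refl =
        let b<m = <-trans b<c c<d ; a<m = <-trans a<b b<m in
        nonCrossing ℓ (s≤s z≤n) (s≤s a<b) (s≤s b<c) c<d
          (edge-sym H (subst₂ (Edge H) (next-< b<m) next-m bd)) (subst₂ (Edge H) (next-< a<m) (next-< c<d) ac)

  rotations : ℕ → OuterLabelling H → OuterLabelling H
  rotations zero    ℓ = ℓ
  rotations (suc k) ℓ = rotations k (rotate ℓ)

  rotations-start : ∀ k ℓ → k ≤ m → vtx (rotations k ℓ) 0 ≡ vtx ℓ k
  rotations-start zero    ℓ _     = refl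
  rotations-start (suc k) ℓ k+1≤m = trans (rotations-start k (rotate ℓ) (<⇒≤ k+1≤m)) (next-< ℓ k+1≤m)

  rotations-end : ∀ k ℓ → k ≤ m → vtx (rotations (suc k) ℓ) m ≡ vtx ℓ k
  rotations-end zero    ℓ _     = next-m ℓ
  rotations-end (suc k) ℓ k+1≤m = trans (rotations-end k (rotate ℓ) (<⇒≤ k+1≤m)) (next-< ℓ k+1≤m)

Consecutive : ∀ {n} → Fin n → Fin n → Set
Consecutive {n} x y = suc (Fin.toℕ x) ≡ Fin.toℕ y ⊎ (Fin.toℕ y ≡ 0 × suc (Fin.toℕ x) ≡ n)

outerPair-consecutive : ∀ {n x y} → OuterPair n x y → Consecutive x y ⊎ Consecutive y x
outerPair-consecutive (inj₁ x→y)               = inj₁ (inj₁ x→y)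
outerPair-consecutive (inj₂ (inj₁ y→x))        = inj₂ (inj₁ y→x)
outerPair-consecutive (inj₂ (inj₂ (inj₁ y→x))) = inj₂ (inj₂ y→x)
outerPair-consecutive (inj₂ (inj₂ (inj₂ x→y))) = inj₁ (inj₂ x→y)

module _ {m : ℕ} {H : Graph (suc m)} (BO : BiconnectedOuterplane H) where

  open OuterLabelling

  atLeast3⇒0<m : 0 < m
  atLeast3⇒0<m = ≤-pred (≤-trans (s≤s (s≤s z≤n)) (BiconnectedOuterplane.atLeast3 BO))

  labelling-ending-at : ∀ {x y} → Consecutive x y → ∃ λ ℓ → vtx ℓ m ≡ x × vtx ℓ 0 ≡ y
  labelling-ending-at {x} {y} (inj₁ x+1≡y) =
    rotations atLeast3⇒0<m (Fin.toℕ y) ι ,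
    subst (λ k → vtx (rotations atLeast3⇒0<m k ι) m ≡ x) x+1≡y
      (trans (rotations-end atLeast3⇒0<m (Fin.toℕ x) ι (Fin.toℕ≤pred[n] x)) (standardLabelling-toℕ BO x)) ,
    trans (rotations-start atLeast3⇒0<m (Fin.toℕ y) ι (Fin.toℕ≤pred[n] y)) (standardLabelling-toℕ BO y)
    where ι = standardLabelling BO
  labelling-ending-at {x} {y} (inj₂ (y≡0 , x+1≡n)) =
    ι ,
    trans (cong (vtx ι) (≡.sym (suc-injective x+1≡n))) (standardLabelling-toℕ BO x) ,
    trans (cong (vtx ι) (≡.sym y≡0)) (standardLabelling-toℕ BO y)
    where ι = standardLabelling BO

module _ {P : ℕ → Set} (P? : ∀ n → Dec (P n)) where

  greatestBelow : ∀ {s c} → s < c → P s →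
                  ∃ λ b → s ≤ b × b < c × P b × (∀ {q} → b < q → q < c → ¬ P q)
  greatestBelow {s} {suc c} s<c+1 Ps with P? c
  ... | yes Pc = c , ≤-pred s<c+1 , ≤-refl , Pc , λ c<q q<c+1 _ → <⇒≱ c<q (≤-pred q<c+1)
  ... | no ¬Pc with m≤n⇒m<n∨m≡n (≤-pred s<c+1)
  ...   | inj₂ refl = ⊥-elim (¬Pc Ps)
  ...   | inj₁ s<c with greatestBelow s<c Ps
  ...     | b , s≤b , b<c , Pb , none = b , s≤b , m≤n⇒m≤1+n b<c , Pb , beyond
    where
    beyond : ∀ {q} → b < q → q < suc c → ¬ P q
    beyond b<q q<c+1 with m≤n⇒m<n∨m≡n (≤-pred q<c+1)
    ... | inj₁ q<c  = none b<q q<c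
    ... | inj₂ refl = ¬Pc

⌈m+n/2⌉≤⌈m/2⌉+⌈n/2⌉ : ∀ m n → ⌈ m + n /2⌉ ≤ ⌈ m /2⌉ + ⌈ n /2⌉
⌈m+n/2⌉≤⌈m/2⌉+⌈n/2⌉ zero          n = ≤-refl
⌈m+n/2⌉≤⌈m/2⌉+⌈n/2⌉ (suc zero)    n = s≤s (⌊n/2⌋≤⌈n/2⌉ n)
⌈m+n/2⌉≤⌈m/2⌉+⌈n/2⌉ (suc (suc m)) n = s≤s (⌈m+n/2⌉≤⌈m/2⌉+⌈n/2⌉ m n)

⌊1+m+n/2⌋≤⌊m/2⌋+⌈n/2⌉⊎⌈m/2⌉+⌊n/2⌋ :
  ∀ m n → ⌊ suc (m + n) /2⌋ ≤ ⌊ m /2⌋ + ⌈ n /2⌉ ⊎ ⌊ suc (m + n) /2⌋ ≤ ⌈ m /2⌉ + ⌊ n /2⌋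
⌊1+m+n/2⌋≤⌊m/2⌋+⌈n/2⌉⊎⌈m/2⌉+⌊n/2⌋ zero          n = inj₁ ≤-refl
⌊1+m+n/2⌋≤⌊m/2⌋+⌈n/2⌉⊎⌈m/2⌉+⌊n/2⌋ (suc zero)    n = inj₂ ≤-refl
⌊1+m+n/2⌋≤⌊m/2⌋+⌈n/2⌉⊎⌈m/2⌉+⌊n/2⌋ (suc (suc m)) n =
  Sum.map s≤s s≤s (⌊1+m+n/2⌋≤⌊m/2⌋+⌈n/2⌉⊎⌈m/2⌉+⌊n/2⌋ m n)

⌈1+m+n/2⌉≤1+⌊m/2⌋+⌊n/2⌋⊎⌈m/2⌉+⌈n/2⌉ :
  ∀ m n → ⌈ suc (m + n) /2⌉ ≤ suc (⌊ m /2⌋ + ⌊ n /2⌋) ⊎ ⌈ suc (m + n) /2⌉ ≤ ⌈ m /2⌉ + ⌈ n /2⌉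
⌈1+m+n/2⌉≤1+⌊m/2⌋+⌊n/2⌋⊎⌈m/2⌉+⌈n/2⌉ zero          n = inj₁ ≤-refl
⌈1+m+n/2⌉≤1+⌊m/2⌋+⌊n/2⌋⊎⌈m/2⌉+⌈n/2⌉ (suc zero)    n = inj₂ ≤-refl
⌈1+m+n/2⌉≤1+⌊m/2⌋+⌊n/2⌋⊎⌈m/2⌉+⌈n/2⌉ (suc (suc m)) n =
  Sum.map s≤s s≤s (⌈1+m+n/2⌉≤1+⌊m/2⌋+⌊n/2⌋⊎⌈m/2⌉+⌈n/2⌉ m n)

module Cacti {m : ℕ} {H : Graph (suc m)} (ℓ : OuterLabelling H) where

  open OuterLabelling ℓ

  infix 4 _~_
  _~_ : ℕ → ℕ → Set
  p ~ q = Edge H (vtx p) (vtx q)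

  _~?_ : ∀ p q → Dec (p ~ q)
  p ~? q = adj H (vtx p) (vtx q) Bool.≟ true

  pos : Fin (suc m) → ℕ
  pos w = proj₁ (surjective w)

  pos≤m : ∀ w → pos w ≤ m
  pos≤m w = proj₁ (proj₂ (surjective w))

  vtx-pos : ∀ w → vtx (pos w) ≡ w
  vtx-pos w = proj₂ (proj₂ (surjective w))

  pos-vtx : ∀ {p} → p ≤ m → pos (vtx p) ≡ p
  pos-vtx p≤m = injective (pos≤m _) p≤m (vtx-pos _)

  [_⋯_] [_⋯_⟩ ⟨_⋯_] : ℕ → ℕ → Pred ℕ 0ℓ
  [ a ⋯ c ] p = a ≤ p × p ≤ c
  [ a ⋯ c ⟩ p = a ≤ p × p < c
  ⟨ a ⋯ c ] p = a < p × p ≤ c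

  record Piece (I : Pred ℕ 0ℓ) (k : ℕ) : Set where
    field
      triangles : List (Triple (suc m))
      tree      : TriangleTree triangles
      inH       : All (Triangle H) triangles
      within    : ∀ {w} → Touches triangles w → I (pos w)
      size      : k ≤ length triangles

  open Piece

  MeetAt : List (Triple (suc m)) → List (Triple (suc m)) → Fin (suc m) → Set
  MeetAt L₁ L₂ v = ∀ {w} → Touches L₁ w → Touches L₂ w → w ≡ v

  meetAt : ∀ {I J k k′} q (P : Piece I k) (Q : Piece J k′) → (∀ {p} → I p → J p → p ≡ q) →
           MeetAt (triangles P) (triangles Q) (vtx q)
  meetAt q P Q I∩J⊆q w∈P w∈Q = trans (≡.sym (vtx-pos _)) (cong vtx (I∩J⊆q (within P w∈P) (within Q w∈Q)))

  meetAt-++ˡ : ∀ L₁ {L₂ L v} → MeetAt L₁ L v → MeetAt L₂ L v → MeetAt (L₁ ++ L₂) L v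
  meetAt-++ˡ L₁ m₁ m₂ w∈ w∈L = [ (λ w∈₁ → m₁ w∈₁ w∈L) , (λ w∈₂ → m₂ w∈₂ w∈L) ]′ (Any.++⁻ L₁ w∈)

  meetAt-++ʳ : ∀ L₁ {L₂ L v} → MeetAt L L₁ v → MeetAt L L₂ v → MeetAt L (L₁ ++ L₂) v
  meetAt-++ʳ L₁ m₁ m₂ w∈L w∈ = [ m₁ w∈L , m₂ w∈L ]′ (Any.++⁻ L₁ w∈)

  noPiece : ∀ {I} → Piece I 0
  noPiece = record { triangles = [] ; tree = empty ; inH = [] ; within = λ () ; size = z≤n }

  weaken : ∀ {I J k k′} → (∀ {p} → I p → J p) → k′ ≤ k → Piece I k → Piece J k′
  weaken I⊆J k′≤k P = record
    { triangles = triangles P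
    ; tree      = tree P
    ; inH       = inH P
    ; within    = λ w∈P → I⊆J (within P w∈P)
    ; size      = ≤-trans k′≤k (size P)
    }

  trianglePiece : ∀ {a b c} → a ≤ m → b ≤ m → c ≤ m → a ~ b → b ~ c → a ~ c →
                  Piece (｛ a ｝ ∪ ｛ b ｝ ∪ ｛ c ｝) 1
  trianglePiece {a} {b} {c} a≤m b≤m c≤m ab bc ac = record
    { triangles = (vtx a , vtx b , vtx c) ∷ []
    ; tree      = single (triangle-distinct H (ab , bc , ac))
    ; inH       = (ab , bc , ac) ∷ []
    ; within    = λ { (here 1st) → inj₁ (≡.sym (pos-vtx a≤m))
                    ; (here 2nd) → inj₂ (inj₁ (≡.sym (pos-vtx b≤m)))
                    ; (here 3rd) → inj₂ (inj₂ (≡.sym (pos-vtx c≤m))) }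
    ; size      = ≤-refl
    }

  glueAt : ∀ {I J k k′} v (P : Piece I k) (Q : Piece J k′) → MeetAt (triangles P) (triangles Q) v →
           Piece (I ∪ J) (k + k′)
  glueAt v P Q meet = record
    { triangles = triangles P ++ triangles Q
    ; tree      = glue v meet (tree P) (tree Q)
    ; inH       = All.++⁺ (inH P) (inH Q)
    ; within    = λ w∈ → Sum.map (within P) (within Q) (Any.++⁻ (triangles P) w∈)
    ; size      = ≤-trans (+-mono-≤ (size P) (size Q)) (≤-reflexive (≡.sym (length-++ (triangles P))))
    }

  record Split (a c k : ℕ) : Set where
    field
      kₗ kᵣ : ℕ
      left  : Piece [ a ⋯ c ⟩ kₗ
      right : Piece ⟨ a ⋯ c ] kᵣ
      apart : ∀ {w} → Touches (triangles left) w → Touches (triangles right) w → ⊥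
      total : k ≤ kₗ + kᵣ

  open Split

  noSplit : ∀ {a c} → Split a c 0
  noSplit = record { kₗ = 0 ; kᵣ = 0 ; left = noPiece ; right = noPiece ; apart = λ () ; total = z≤n }

  shrinkSplit : ∀ {a c k k′} → k′ ≤ k → Split a c k → Split a c k′
  shrinkSplit k′≤k S = record
    { kₗ = kₗ S ; kᵣ = kᵣ S ; left = left S ; right = right S ; apart = apart S ; total = ≤-trans k′≤k (total S) }

  module Gluing {a b c : ℕ} (a<b : a < b) (b<c : b < c) (c≤m : c ≤ m) where

    private
      a≤b = <⇒≤ a<b
      b≤c = <⇒≤ b<c
      b≤m = ≤-trans b≤c c≤m
      a≤m = ≤-trans a≤b b≤m

      meet-at-b : ∀ {A B : Set} {p} → A × p ≤ b → b ≤ p × B → p ≡ b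
      meet-at-b (_ , p≤b) (b≤p , _) = ≤-antisym p≤b b≤p

    glueWholes : ∀ {k k′} → Piece [ a ⋯ b ] k → Piece [ b ⋯ c ] k′ → Piece [ a ⋯ c ] (k + k′)
    glueWholes P Q =
      weaken [ (λ (a≤p , p≤b) → a≤p , ≤-trans p≤b b≤c) , (λ (b≤p , p≤c) → ≤-trans a≤b b≤p , p≤c) ]′ ≤-refl
        (glueAt (vtx b) P Q (meetAt b P Q meet-at-b))

    extendRight : ∀ {k k′} → Split a b k → Piece [ b ⋯ c ] k′ → Split a c (k + k′)
    extendRight {k′ = k′} S P = record
      { kₗ    = kₗ S
      ; kᵣ    = kᵣ S + k′
      ; left  = weaken (λ (a≤p , p<b) → a≤p , <-trans p<b b<c) ≤-refl (left S)
      ; right = weaken [ (λ (a<p , p≤b) → a<p , ≤-trans p≤b b≤c) , (λ (b≤p , p≤c) → <-≤-trans a<b b≤p , p≤c) ]′ ≤-refl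
                  (glueAt (vtx b) (right S) P (meetAt b (right S) P meet-at-b))
      ; apart = λ w∈l w∈r →
          [ apart S w∈l , (λ w∈P → <⇒≱ (proj₂ (within (left S) w∈l)) (proj₁ (within P w∈P))) ]′
          (Any.++⁻ (triangles (right S)) w∈r)
      ; total = ≤-trans (+-monoˡ-≤ k′ (total S)) (≤-reflexive (+-assoc (kₗ S) (kᵣ S) k′))
      }

    extendLeft : ∀ {k k′} → Piece [ a ⋯ b ] k → Split b c k′ → Split a c (k + k′)
    extendLeft {k} P S = record
      { kₗ    = k + kₗ S
      ; kᵣ    = kᵣ S
      ; left  = weaken [ (λ (a≤p , p≤b) → a≤p , ≤-<-trans p≤b b<c) , (λ (b≤p , p<c) → ≤-trans a≤b b≤p , p<c) ]′ ≤-refl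
                  (glueAt (vtx b) P (left S) (meetAt b P (left S) meet-at-b))
      ; right = weaken (λ (b<p , p≤c) → <-trans a<b b<p , p≤c) ≤-refl (right S)
      ; apart = λ w∈l w∈r →
          [ (λ w∈P → <⇒≱ (proj₁ (within (right S) w∈r)) (proj₂ (within P w∈P))) , (λ w∈l′ → apart S w∈l′ w∈r) ]′
          (Any.++⁻ (triangles P) w∈l)
      ; total = ≤-trans (+-monoʳ-≤ k (total S)) (≤-reflexive (≡.sym (+-assoc k (kₗ S) (kᵣ S))))
      }

    -- abc meets Xₗ in a, Yᵣ in c and Xᵣ ∪ Yₗ in b, so the five pieces glue into one tree.
    closeTriangle : ∀ {k k′} → Split a b k → Split b c k′ → a ~ b → b ~ c → a ~ c → Piece [ a ⋯ c ] (suc (k + k′))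
    closeTriangle {k} {k′} X Y ab bc ac =
      weaken inside count (glueAt (vtx b) (glueAt (vtx c) (glueAt (vtx a) Xₗ Δ Xₗ-Δ) Yᵣ XₗΔ-Yᵣ) (glueAt (vtx b) Xᵣ Yₗ Xᵣ-Yₗ) outer-inner)
      where
      Xₗ = left X
      Xᵣ = right X
      Yₗ = left Y
      Yᵣ = right Y
      Δ  = trianglePiece a≤m b≤m c≤m ab bc ac

      Xₗ-Δ : MeetAt (triangles Xₗ) (triangles Δ) (vtx a)
      Xₗ-Δ = meetAt a Xₗ Δ λ
        { _         (inj₁ refl)        → refl
        ; (_ , b<b) (inj₂ (inj₁ refl)) → ⊥-elim (<-irrefl refl b<b)
        ; (_ , c<b) (inj₂ (inj₂ refl)) → ⊥-elim (<-asym c<b b<c) }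

      XₗΔ-Yᵣ : MeetAt (triangles Xₗ ++ triangles Δ) (triangles Yᵣ) (vtx c)
      XₗΔ-Yᵣ = meetAt-++ˡ (triangles Xₗ)
        (meetAt c Xₗ Yᵣ λ (_ , p<b) (b<p , _) → ⊥-elim (<-asym p<b b<p))
        (meetAt c Δ Yᵣ λ
          { (inj₁ refl)               (b<a , _) → ⊥-elim (<-asym a<b b<a)
          ; (inj₂ (inj₁ refl))        (b<b , _) → ⊥-elim (<-irrefl refl b<b)
          ; (inj₂ (inj₂ refl))        _         → refl })

      Xᵣ-Yₗ : MeetAt (triangles Xᵣ) (triangles Yₗ) (vtx b)
      Xᵣ-Yₗ = meetAt b Xᵣ Yₗ meet-at-b

      outer-inner : MeetAt ((triangles Xₗ ++ triangles Δ) ++ triangles Yᵣ) (triangles Xᵣ ++ triangles Yₗ) (vtx b)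
      outer-inner = meetAt-++ˡ (triangles Xₗ ++ triangles Δ) (meetAt-++ˡ (triangles Xₗ) Xₗ-inner Δ-inner) Yᵣ-inner
        where
        Xₗ-inner : MeetAt (triangles Xₗ) (triangles Xᵣ ++ triangles Yₗ) (vtx b)
        Xₗ-inner = meetAt-++ʳ (triangles Xᵣ)
          (λ w∈Xₗ w∈Xᵣ → ⊥-elim (apart X w∈Xₗ w∈Xᵣ))
          (meetAt b Xₗ Yₗ λ (_ , p<b) (b≤p , _) → ⊥-elim (<⇒≱ p<b b≤p))

        Δ-inner : MeetAt (triangles Δ) (triangles Xᵣ ++ triangles Yₗ) (vtx b)
        Δ-inner = meetAt-++ʳ (triangles Xᵣ)
          (meetAt b Δ Xᵣ λ
            { (inj₁ refl)        (a<a , _) → ⊥-elim (<-irrefl refl a<a)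
            ; (inj₂ (inj₁ refl)) _         → refl
            ; (inj₂ (inj₂ refl)) (_ , c≤b) → ⊥-elim (<⇒≱ b<c c≤b) })
          (meetAt b Δ Yₗ λ
            { (inj₁ refl)        (b≤a , _) → ⊥-elim (<⇒≱ a<b b≤a)
            ; (inj₂ (inj₁ refl)) _         → refl
            ; (inj₂ (inj₂ refl)) (_ , c<c) → ⊥-elim (<-irrefl refl c<c) })

        Yᵣ-inner : MeetAt (triangles Yᵣ) (triangles Xᵣ ++ triangles Yₗ) (vtx b)
        Yᵣ-inner = meetAt-++ʳ (triangles Xᵣ)
          (meetAt b Yᵣ Xᵣ λ (b<p , _) (_ , p≤b) → ⊥-elim (<⇒≱ b<p p≤b))
          (λ w∈Yᵣ w∈Yₗ → ⊥-elim (apart Y w∈Yₗ w∈Yᵣ))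

      inside : ∀ {p} → ((([ a ⋯ b ⟩ ∪ (｛ a ｝ ∪ ｛ b ｝ ∪ ｛ c ｝)) ∪ ⟨ b ⋯ c ]) ∪ (⟨ a ⋯ b ] ∪ [ b ⋯ c ⟩)) p → [ a ⋯ c ] p
      inside (inj₁ (inj₁ (inj₁ (a≤p , p<b))))        = a≤p , ≤-trans (<⇒≤ p<b) b≤c
      inside (inj₁ (inj₁ (inj₂ (inj₁ refl))))        = ≤-refl , ≤-trans a≤b b≤c
      inside (inj₁ (inj₁ (inj₂ (inj₂ (inj₁ refl))))) = a≤b , b≤c
      inside (inj₁ (inj₁ (inj₂ (inj₂ (inj₂ refl))))) = ≤-trans a≤b b≤c , ≤-refl
      inside (inj₁ (inj₂ (b<p , p≤c)))               = ≤-trans a≤b (<⇒≤ b<p) , p≤c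
      inside (inj₂ (inj₁ (a<p , p≤b)))               = <⇒≤ a<p , ≤-trans p≤b b≤c
      inside (inj₂ (inj₂ (b≤p , p<c)))               = ≤-trans a≤b b≤p , <⇒≤ p<c

      count : suc (k + k′) ≤ ((kₗ X + 1) + kᵣ Y) + (kᵣ X + kₗ Y)
      count = ≤-trans (s≤s (+-mono-≤ (total X) (total Y)))
                      (≤-reflexive (rearrange (kₗ X) (kᵣ X) (kₗ Y) (kᵣ Y)))
        where
        open +-*-Solver
        rearrange : ∀ xₗ xᵣ yₗ yᵣ → suc ((xₗ + xᵣ) + (yₗ + yᵣ)) ≡ ((xₗ + 1) + yᵣ) + (xᵣ + yₗ)
        rearrange = solve 4 (λ xₗ xᵣ yₗ yᵣ → con 1 :+ ((xₗ :+ xᵣ) :+ (yₗ :+ yᵣ)) := ((xₗ :+ con 1) :+ yᵣ) :+ (xᵣ :+ yₗ)) refl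

  triangle-split : ∀ {a b c} → a < b → b < c → c ≤ m → a ~ b → (∀ {q} → b < q → q < c → ¬ a ~ q) →
                   ∀ {p q r} → a ≤ p → p < q → q < r → r ≤ c → p ~ q → q ~ r → p ~ r →
                   r ≤ b ⊎ b ≤ p ⊎ (p ≡ a × q ≡ b × r ≡ c)
  triangle-split {a} {b} {c} a<b b<c c≤m a~b greatest {p} {q} {r} a≤p p<q q<r r≤c p~q q~r p~r
    with r ≤? b | b ≤? p
  ... | yes r≤b | _       = inj₁ r≤b
  ... | no _    | yes b≤p = inj₂ (inj₁ b≤p)
  ... | no r≰b  | no b≰p  with m≤n⇒m<n∨m≡n a≤p
  ...   | inj₁ a<p = ⊥-elim (nonCrossing a<p (≰⇒> b≰p) (≰⇒> r≰b) (≤-trans r≤c c≤m) a~b p~r)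
  ...   | inj₂ refl with m≤n⇒m<n∨m≡n r≤c
  ...     | inj₁ r<c  = ⊥-elim (greatest (≰⇒> r≰b) r<c p~r)
  ...     | inj₂ refl with <-cmp q b
  ...       | tri< q<b _ _ = ⊥-elim (nonCrossing p<q q<b b<c c≤m a~b q~r)
  ...       | tri≈ _ q≡b _ = inj₂ (inj₂ (refl , q≡b , refl))
  ...       | tri> _ _ b<q = ⊥-elim (greatest b<q q<r p~q)

  record Decomposition (a c : ℕ) : Set where
    field
      covering : List (Triple (suc m))
      covers   : ∀ {p q r} → a ≤ p → p < q → q < r → r ≤ c → p ~ q → q ~ r → p ~ r →
                 (vtx p , vtx q , vtx r) ∈ covering
      whole    : Piece [ a ⋯ c ] ⌈ length covering /2⌉
      split    : Split a c ⌊ length covering /2⌋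

  open Decomposition

  trivialDecomposition : ∀ {a} → Decomposition a (suc a)
  trivialDecomposition = record
    { covering = []
    ; covers   = λ a≤p p<q q<r r≤a+1 _ _ _ →
                   ⊥-elim (<⇒≱ (≤-<-trans a≤p p<q) (≤-pred (<-≤-trans q<r r≤a+1)))
    ; whole    = noPiece
    ; split    = noSplit
    }

  combine : ∀ {a b c} → a < b → b < c → c ≤ m → a ~ b → (∀ {q} → b < q → q < c → ¬ a ~ q) →
            Decomposition a b → Decomposition b c → Decomposition a c
  combine {a} {b} {c} a<b b<c c≤m a~b greatest D₀ D₁ = byTriangle ((a ~? c) ×-dec (b ~? c))
    where
    open Gluing a<b b<c c≤m
    x = length (covering D₀)
    y = length (covering D₁)
    covering₀₁ = covering D₀ ++ covering D₁

    length₀₁ : length covering₀₁ ≡ x + y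
    length₀₁ = length-++ (covering D₀)

    ⌈⌉-length : ∀ i → ⌈ i + length covering₀₁ /2⌉ ≤ ⌈ i + (x + y) /2⌉
    ⌈⌉-length i = ⌈n/2⌉-mono (≤-reflexive (cong (i +_) length₀₁))

    covered : ∀ {p q r} → a ≤ p → p < q → q < r → r ≤ c → p ~ q → q ~ r → p ~ r →
              (vtx p , vtx q , vtx r) ∈ covering₀₁ ⊎ (p ≡ a × q ≡ b × r ≡ c)
    covered a≤p p<q q<r r≤c p~q q~r p~r with triangle-split a<b b<c c≤m a~b greatest a≤p p<q q<r r≤c p~q q~r p~r
    ... | inj₁ r≤b        = inj₁ (∈-++⁺ˡ (covers D₀ a≤p p<q q<r r≤b p~q q~r p~r))
    ... | inj₂ (inj₁ b≤p) = inj₁ (∈-++⁺ʳ (covering D₀) (covers D₁ b≤p p<q q<r r≤c p~q q~r p~r))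
    ... | inj₂ (inj₂ abc) = inj₂ abc

    split₀₁ : Split a c ⌊ suc (x + y) /2⌋
    split₀₁ = [ (λ h → shrinkSplit h (extendRight (split D₀) (whole D₁)))
              , (λ h → shrinkSplit h (extendLeft (whole D₀) (split D₁))) ]′
              (⌊1+m+n/2⌋≤⌊m/2⌋+⌈n/2⌉⊎⌈m/2⌉+⌊n/2⌋ x y)

    byTriangle : Dec (a ~ c × b ~ c) → Decomposition a c
    byTriangle (yes (a~c , b~c)) = record
      { covering = (vtx a , vtx b , vtx c) ∷ covering₀₁
      ; covers   = λ a≤p p<q q<r r≤c p~q q~r p~r →
          [ there , (λ { (refl , refl , refl) → here refl }) ]′ (covered a≤p p<q q<r r≤c p~q q~r p~r)
      ; whole    = [ (λ h → weaken id (≤-trans (⌈⌉-length 1) h) (closeTriangle (split D₀) (split D₁) a~b b~c a~c))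
                   , (λ h → weaken id (≤-trans (⌈⌉-length 1) h) (glueWholes (whole D₀) (whole D₁))) ]′
                   (⌈1+m+n/2⌉≤1+⌊m/2⌋+⌊n/2⌋⊎⌈m/2⌉+⌈n/2⌉ x y)
      ; split    = shrinkSplit (⌊n/2⌋-mono (≤-reflexive (cong suc length₀₁))) split₀₁
      }
    byTriangle (no ¬abc) = record
      { covering = covering₀₁
      ; covers   = λ a≤p p<q q<r r≤c p~q q~r p~r →
          [ id , (λ { (refl , refl , refl) → ⊥-elim (¬abc (p~r , q~r)) }) ]′
          (covered a≤p p<q q<r r≤c p~q q~r p~r)
      ; whole    = weaken id (≤-trans (⌈⌉-length 0) (⌈m+n/2⌉≤⌈m/2⌉+⌈n/2⌉ x y)) (glueWholes (whole D₀) (whole D₁))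
      ; split    = shrinkSplit (⌊n/2⌋-mono (≤-trans (≤-reflexive length₀₁) (m≤n⇒m≤1+n ≤-refl))) split₀₁
      }

  decompose : ∀ k {a c} → a < c → c ≤ a + k → c ≤ m → Decomposition a c
  decompose zero    {a} a<c c≤a+0 _ = ⊥-elim (<⇒≱ a<c (subst (_ ≤_) (+-identityʳ a) c≤a+0))
  decompose (suc k) {a} {c} a<c c≤a+k+1 c≤m with m≤n⇒m<n∨m≡n a<c
  ... | inj₂ refl  = trivialDecomposition
  ... | inj₁ a+1<c with greatestBelow (a ~?_) a+1<c (consecutive (<-≤-trans a<c c≤m))
  ...   | b , a<b , b<c , a~b , greatest =
    combine a<b b<c c≤m a~b greatest
      (decompose k a<b (≤-pred (<-≤-trans b<c c≤1+a+k)) (≤-trans (<⇒≤ b<c) c≤m))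
      (decompose k b<c (≤-trans c≤1+a+k (+-monoˡ-≤ k a<b)) c≤m)
    where c≤1+a+k = subst (c ≤_) (+-suc a k) c≤a+k+1

  fullDecomposition : 0 < m → Decomposition 0 m
  fullDecomposition 0<m = decompose m 0<m ≤-refl ≤-refl

  triangle-covered : (D : Decomposition 0 m) → ∀ {s} → Triangle H s → ∃ λ t → t ∈ covering D × s ≈₃ t
  triangle-covered D {s} s△ =
    let x≢y , y≢z , x≢z = triangle-distinct H s△ in
    wlog-sorted (On.trichotomous pos _≡_ _<_ <-cmp) Covered
      (λ covered yxz≈s → covered (≈₃-trans swap₁₂ yxz≈s))
      (λ covered xzy≈s → covered (≈₃-trans swap₂₃ xzy≈s))
      sorted (x≢y ∘ pos-injective) (y≢z ∘ pos-injective) (x≢z ∘ pos-injective) ≈₃-refl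
    where
    pos-injective : ∀ {u w} → pos u ≡ pos w → u ≡ w
    pos-injective {u} {w} e = trans (≡.sym (vtx-pos u)) (trans (cong vtx e) (vtx-pos w))

    Covered : Fin (suc m) → Fin (suc m) → Fin (suc m) → Set
    Covered x y z = (x , y , z) ≈₃ s → ∃ λ t → t ∈ covering D × s ≈₃ t

    sorted : ∀ {x y z} → pos x < pos y → pos y < pos z → Covered x y z
    sorted {x} {y} {z} x<y y<z (xyz⊆s , s⊆xyz) =
      (x , y , z) ,
      subst (_∈ covering D) (cong₂ _,_ (vtx-pos x) (cong₂ _,_ (vtx-pos y) (vtx-pos z)))
        (covers D z≤n x<y y<z (pos≤m z) (edge 1st 2nd x<y) (edge 2nd 3rd y<z) (edge 1st 3rd (<-trans x<y y<z))) ,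
      s⊆xyz , xyz⊆s
      where
      edge : ∀ {u w} → u ∈₃ (x , y , z) → w ∈₃ (x , y , z) → pos u < pos w → pos u ~ pos w
      edge {u} {w} u∈ w∈ u<w =
        subst₂ (Edge H) (≡.sym (vtx-pos u)) (≡.sym (vtx-pos w))
          (triangle-edge H s△ (xyz⊆s u∈) (xyz⊆s w∈) λ { refl → <-irrefl refl u<w })

  numTriangles≤covering : (D : Decomposition 0 m) → numTriangles H ≤ length (covering D)
  numTriangles≤covering D = length-≤-of-cover SortedAs separated cover
    where
    SortedAs : Triple (suc m) → Triple (suc m) → Set
    SortedAs s t = Sorted s × s ≈₃ t

    separated : AllPairs (Separated SortedAs) (trianglesOf H)
    separated = AllPairs.map (λ s≢s′ {_} (s↑ , s≈t) (s′↑ , s′≈t) → s≢s′ (sorted-≈₃⇒≡ s↑ s′↑ (≈₃-trans s≈t (≈₃-sym s′≈t))))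
                  (trianglesOf-unique H)

    cover : ∀ {s} → s ∈ trianglesOf H → ∃ λ t → t ∈ covering D × SortedAs s t
    cover s∈ with ∈-trianglesOf⁻ H s∈
    ... | s↑ , s△ with triangle-covered D s△
    ...   | t , t∈ , s≈t = t , t∈ , s↑ , s≈t

  pieceCactus : ∀ {I k} (P : Piece I k) → CactusIn H (triangleGraph (triangles P)) k
  pieceCactus P = triangleGraph-⊆ {H = H} (inH P) , tree-cactus (tree P) , ≤-trans (size P) (tree-count (tree P))

  halfCactus : 0 < m → ∃ λ C → CactusIn H C ⌈ numTriangles H /2⌉
  halfCactus 0<m =
    let D = fullDecomposition 0<m
        sub , cactus , enough = pieceCactus (whole D)
    in _ , sub , cactus , ≤-trans (⌈n/2⌉-mono (numTriangles≤covering D)) enough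

  separatingCactus : 0 < m → ∃ λ C → CactusIn H C ⌊ numTriangles H /2⌋ × DifferentComponents C (vtx 0) (vtx m)
  separatingCactus 0<m =
    let sub , cactus , enough = pieceCactus both
    in _ ,
       (sub , cactus , ≤-trans (⌊n/2⌋-mono (numTriangles≤covering D)) (≤-trans (total S) enough)) ,
       separated-by-disjointness (apart S)
         (λ t → <-irrefl (≡.sym (pos-vtx z≤n)) (proj₁ (within (right S) t)))
         (λ t → <-irrefl (pos-vtx ≤-refl) (proj₂ (within (left S) t)))
         (λ e → <-irrefl (injective z≤n ≤-refl e) 0<m)
    where
    D = fullDecomposition 0<m
    S = split D
    both = glueAt (vtx 0) (left S) (right S) (λ l r → ⊥-elim (apart S l r))

differentComponents-sym : ∀ {n} (C : Graph n) {x y} → DifferentComponents C x y → DifferentComponents C y x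
differentComponents-sym C x≁y y∼x = x≁y (reverse (edge-sym C) y∼x)

outeredge-separatingCactus : ∀ {m} {H : Graph (suc m)} → BiconnectedOuterplane H → ∀ {x y} → Outeredge H x y →
                             ∃ λ C → CactusIn H C ⌊ innerTriangles H /2⌋ × DifferentComponents C x y
outeredge-separatingCactus BO (_ , outer) with outerPair-consecutive outer
... | inj₁ x→y =
  let ℓ , end , start = labelling-ending-at BO x→y
      C , cactus , separates = Cacti.separatingCactus ℓ (atLeast3⇒0<m BO)
  in C , cactus , differentComponents-sym C (subst₂ (DifferentComponents C) start end separates)
... | inj₂ y→x =
  let ℓ , end , start = labelling-ending-at BO y→x
      C , cactus , separates = Cacti.separatingCactus ℓ (atLeast3⇒0<m BO)
  in C , cactus , subst₂ (DifferentComponents C) start end separates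

lemma1 : ∀ (n : ℕ) (H : Graph n) → BiconnectedOuterplane H →
    (innerTriangles H % 2 ≡ 0 →
      ∀ (x y : Fin n) → Outeredge H x y →
        ∃ λ C → CactusIn H C ⌊ innerTriangles H /2⌋ × DifferentComponents C x y)
    × (innerTriangles H % 2 ≡ 1 →
      (∃ λ C → CactusIn H C ⌈ innerTriangles H /2⌉)
      × (∀ (x y : Fin n) → Outeredge H x y →
          ∃ λ C → CactusIn H C ⌊ innerTriangles H /2⌋ × DifferentComponents C x y))
-- Both cacti exist whatever the parity of t.
lemma1 zero    H BO with () ← BiconnectedOuterplane.atLeast3 BO
lemma1 (suc m) H BO =
  (λ _ _ _ → outeredge-separatingCactus BO) ,
  (λ _ → Cacti.halfCactus (standardLabelling BO) (atLeast3⇒0<m BO) , λ _ _ → outeredge-separatingCactus BO)
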